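{- Let $(G,\circ)$ be a finite group, let $N$ be a $G$-stable regular subgroup of $\mathrm{Perm}(G)$ and let $(G,\star,\circ)$ be the corresponding skew brace. Then $N$ is normalized by $\rho(G)$ if and only if $(G,\star,\circ)$ is a two-sided skew brace.
   Context: $\mathrm{Perm}(G)$ is the group of permutations of the set $G$; $\lambda(g)[h]=g\circ h$, $\rho(g)[h]=h\circ\bar g$ with $\bar g$ the inverse in $(G,\circ)$. A subgroup $N\le\mathrm{Perm}(G)$ is regular if it acts simply transitively on $G$ and $G$-stable if normalized by $\lambda(G)$. The skew brace corresponding to $N$: define $\eta[e_G]\star\mu[e_G]=\eta\mu[e_G]$ for $\eta,\mu\in N$; then $(G,\star)$ is a group and the left skew brace relation $x\circ(y\star z)=(x\circ y)\star x^{ -1}\star(x\circ z)$ holds for all $x,y,z\in G$ ($x^{ -1}$ the $\star$-inverse). The skew brace is two-sided if moreover the right skew brace relation $(y\star z)\circ x=(y\circ x)\star x^{ -1}\star(z\circ x)$ holds for all $x,y,z\in G$. -}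

module Defs where

open import Level using (0ℓ)
open import Data.Nat using (ℕ)
open import Data.Fin using (Fin)
open import Data.Product using (Σ; _×_; _,_; proj₁; proj₂)
open import Function.Bundles using (_↔_)
open import Algebra.Structures using (IsGroup)
open import Relation.Binary.PropositionalEquality
  using (_≡_; refl; sym; trans; cong)

record FiniteGroup : Set₁ where
  infixl 7 _∘_
  field
    Carrier : Set
    _∘_     : Carrier → Carrier → Carrier
    e       : Carrier
    inv     : Carrier → Carrier
    isGroup : IsGroup _≡_ _∘_ e inv
    size    : ℕ
    enum    : Carrier ↔ Fin size

  open IsGroup isGroup public using (assoc; identityˡ; identityʳ; inverseˡ; inverseʳ)

-- Perm(G): permutations of the set G.  Equality of permutations is
-- pointwise equality (no function extensionality in Agda).

module _ (𝔾 : FiniteGroup) where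
  open FiniteGroup 𝔾 renaming (Carrier to G)

  record Perm : Set where
    field
      to      : G → G
      from    : G → G
      to-from : ∀ x → to (from x) ≡ x
      from-to : ∀ x → from (to x) ≡ x
  open Perm public

  infix 4 _≈ₚ_
  _≈ₚ_ : Perm → Perm → Set
  σ ≈ₚ τ = ∀ x → to σ x ≡ to τ x

  idₚ : Perm
  idₚ = record { to = λ x → x ; from = λ x → x
               ; to-from = λ _ → refl ; from-to = λ _ → refl }

  infixl 7 _·_
  _·_ : Perm → Perm → Perm
  σ · τ = record
    { to      = λ x → to σ (to τ x)
    ; from    = λ x → from τ (from σ x)
    ; to-from = λ x → trans (cong (to σ) (to-from τ (from σ x))) (to-from σ x)
    ; from-to = λ x → trans (cong (from τ) (from-to σ (to τ x))) (from-to τ x) }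

  _⁻¹ₚ : Perm → Perm
  σ ⁻¹ₚ = record { to = from σ ; from = to σ
                 ; to-from = from-to σ ; from-to = to-from σ }

  private
    l-law : ∀ a b x → a ∘ b ≡ e → a ∘ (b ∘ x) ≡ x
    l-law a b x p = trans (sym (assoc a b x)) (trans (cong (_∘ x) p) (identityˡ x))

    r-law : ∀ a b x → a ∘ b ≡ e → (x ∘ a) ∘ b ≡ x
    r-law a b x p = trans (assoc x a b) (trans (cong (x ∘_) p) (identityʳ x))

  λₚ : G → Perm
  λₚ g = record { to = λ h → g ∘ h ; from = λ h → inv g ∘ h
                ; to-from = λ h → l-law g (inv g) h (inverseʳ g)
                ; from-to = λ h → l-law (inv g) g h (inverseˡ g) }

  ρₚ : G → Perm
  ρₚ g = record { to = λ h → h ∘ inv g ; from = λ h → h ∘ g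
                ; to-from = λ h → r-law g (inv g) h (inverseʳ g)
                ; from-to = λ h → r-law (inv g) g h (inverseˡ g) }

  record IsSubgroup (N : Perm → Set) : Set where
    field
      resp : ∀ {σ τ} → σ ≈ₚ τ → N σ → N τ     -- N is a set of permutations
      id∈  : N idₚ
      ·∈   : ∀ {σ τ} → N σ → N τ → N (σ · τ)
      ⁻¹∈  : ∀ {σ} → N σ → N (σ ⁻¹ₚ)

  record IsRegular (N : Perm → Set) : Set where
    field
      transitive : ∀ x y → Σ Perm (λ η → N η × to η x ≡ y)
      unique     : ∀ x {η μ} → N η → N μ → to η x ≡ to μ x → η ≈ₚ μ

  NormalizedBy : (G → Perm) → (Perm → Set) → Set
  NormalizedBy π N = ∀ g η → N η → N (π g · η · (π g) ⁻¹ₚ)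

  GStable : (Perm → Set) → Set
  GStable N = NormalizedBy λₚ N

  -- The skew brace corresponding to a regular N:
  -- η[e] ⋆ μ[e] = ημ[e]; each x equals η_x[e] for the unique η_x ∈ N.

  module SkewBrace (N : Perm → Set) (reg : IsRegular N) where
    open IsRegular reg

    ηof : G → Perm
    ηof x = proj₁ (transitive e x)

    infixl 6 _⋆_
    _⋆_ : G → G → G
    x ⋆ y = to (ηof x · ηof y) e

    -- x' is the ⋆-inverse of x (identity of (G,⋆) is e = idₚ[e])
    IsStarInverse : G → G → Set
    IsStarInverse x x' = (x ⋆ x' ≡ e) × (x' ⋆ x ≡ e)

    LeftBrace : Set
    LeftBrace = ∀ x x' y z → IsStarInverse x x' →
                x ∘ (y ⋆ z) ≡ (x ∘ y) ⋆ x' ⋆ (x ∘ z)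

    RightBrace : Set
    RightBrace = ∀ x x' y z → IsStarInverse x x' →
                 (y ⋆ z) ∘ x ≡ (y ∘ x) ⋆ x' ⋆ (z ∘ x)

    IsTwoSided : Set
    IsTwoSided = LeftBrace × RightBrace

{-# OPTIONS --safe #-}
module Submission where

-- A permutation π normalizes N exactly when it transports the brace
-- multiplication as π (y ⋆ z) = π y ⋆ p' ⋆ π z, where p' is the
-- ⋆-inverse of π e: by regularity, π ∙ η_y ∙ π⁻¹ ∈ N is pinned down by
-- its value at π e, where it agrees with η_{π y} ∙ η_{p'}; conversely the
-- identity exhibits π ∙ η_y ∙ π⁻¹ as η_{π y ⋆ p'}.  For π = λ(x) this is
-- the left brace relation, which G-stability supplies; for π = ρ(x̄) it is
-- the right brace relation at x.

open import Defs
open import Function using (_∘′_)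
open import Data.Product using (_×_; _,_; proj₁; proj₂)
open import Relation.Binary.PropositionalEquality
  using (_≡_; sym; trans; cong; subst; module ≡-Reasoning)
import Algebra.Properties.Group as GroupProperties

module _ (𝔾 : FiniteGroup) (N : Perm 𝔾 → Set)
         (sub : IsSubgroup 𝔾 N) (reg : IsRegular 𝔾 N) where
  open FiniteGroup 𝔾 renaming (Carrier to G)
  open IsSubgroup sub
  open IsRegular reg
  open SkewBrace 𝔾 N reg
  open ≡-Reasoning

  private
    infix 4 _≈_
    infixl 7 _∙_
    infix 8 _⁻¹

    _≈_ : Perm 𝔾 → Perm 𝔾 → Set
    _≈_ = _≈ₚ_ 𝔾

    _∙_ : Perm 𝔾 → Perm 𝔾 → Perm 𝔾
    _∙_ = _·_ 𝔾

    _⁻¹ : Perm 𝔾 → Perm 𝔾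
    _⁻¹ = _⁻¹ₚ 𝔾

  inv-involutive : ∀ x → inv (inv x) ≡ x
  inv-involutive = GroupProperties.⁻¹-involutive (record { isGroup = isGroup })

  ηof-e : ∀ x → to (ηof x) e ≡ x
  ηof-e x = proj₂ (proj₂ (transitive e x))

  ηof∈N : ∀ x → N (ηof x)
  ηof∈N x = proj₁ (proj₂ (transitive e x))

  ⋆-ηof : ∀ x y → x ⋆ y ≡ to (ηof x) y
  ⋆-ηof x y = cong (to (ηof x)) (ηof-e y)

  ηof-unique : ∀ {η} → N η → η ≈ ηof (to η e)
  ηof-unique {η} η∈N = unique e η∈N (ηof∈N (to η e)) (sym (ηof-e (to η e)))

  ⋆-⋆-ηof : ∀ a b c → (a ⋆ b) ⋆ c ≡ to (ηof a ∙ ηof b) c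
  ⋆-⋆-ηof a b c = trans (⋆-ηof (a ⋆ b) c)
    (unique e (ηof∈N (a ⋆ b)) (·∈ (ηof∈N a) (ηof∈N b)) (ηof-e (a ⋆ b)) c)

  ⋆-inverse : ∀ x → IsStarInverse x (from (ηof x) e)
  ⋆-inverse x = x⋆x'≡e , x'⋆x≡e
    where
    x' : G
    x' = from (ηof x) e

    x⋆x'≡e : x ⋆ x' ≡ e
    x⋆x'≡e = trans (⋆-ηof x x') (to-from (ηof x) e)

    ηof-x'≈ηof-x⁻¹ : ηof x' ≈ ηof x ⁻¹
    ηof-x'≈ηof-x⁻¹ = unique e (ηof∈N x') (⁻¹∈ (ηof∈N x)) (ηof-e x')

    x'⋆x≡e : x' ⋆ x ≡ e
    x'⋆x≡e = begin
      x' ⋆ x                          ≡⟨ ⋆-ηof x' x ⟩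
      to (ηof x') x                   ≡⟨ ηof-x'≈ηof-x⁻¹ x ⟩
      from (ηof x) x                  ≡⟨ cong (from (ηof x)) (sym (ηof-e x)) ⟩
      from (ηof x) (to (ηof x) e)     ≡⟨ from-to (ηof x) e ⟩
      e                               ∎

  Normalizes : Perm 𝔾 → Set
  Normalizes π = ∀ η → N η → N (π ∙ η ∙ π ⁻¹)

  TransportsBrace : Perm 𝔾 → G → Set
  TransportsBrace π p' = ∀ y z → to π (y ⋆ z) ≡ (to π y ⋆ p') ⋆ to π z

  normalizes⇒transportsBrace : ∀ π {p'} → p' ⋆ to π e ≡ e →
                               Normalizes π → TransportsBrace π p'
  normalizes⇒transportsBrace π {p'} p'⋆πe≡e π-normalizes y z = begin
    to π (y ⋆ z)                          ≡⟨ cong (to π) (⋆-ηof y z) ⟩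
    to π (to (ηof y) z)                   ≡⟨ cong (to π ∘′ to (ηof y)) (sym (from-to π z)) ⟩
    to ν (to π z)                         ≡⟨ ν≈ηof-πy∙ηof-p' (to π z) ⟩
    to (ηof (to π y) ∙ ηof p') (to π z)   ≡⟨ sym (⋆-⋆-ηof (to π y) p' (to π z)) ⟩
    (to π y ⋆ p') ⋆ to π z                ∎
    where
    ν : Perm 𝔾
    ν = π ∙ ηof y ∙ π ⁻¹

    ηof-p'-πe : to (ηof p') (to π e) ≡ e
    ηof-p'-πe = trans (sym (⋆-ηof p' (to π e))) p'⋆πe≡e

    ν-πe : to ν (to π e) ≡ to (ηof (to π y) ∙ ηof p') (to π e)
    ν-πe = begin
      to π (to (ηof y) (from π (to π e)))        ≡⟨ cong (to π ∘′ to (ηof y)) (from-to π e) ⟩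
      to π (to (ηof y) e)                        ≡⟨ cong (to π) (ηof-e y) ⟩
      to π y                                     ≡⟨ sym (ηof-e (to π y)) ⟩
      to (ηof (to π y)) e                        ≡⟨ cong (to (ηof (to π y))) (sym ηof-p'-πe) ⟩
      to (ηof (to π y)) (to (ηof p') (to π e))   ∎

    ν≈ηof-πy∙ηof-p' : ν ≈ ηof (to π y) ∙ ηof p'
    ν≈ηof-πy∙ηof-p' = unique (to π e) (π-normalizes (ηof y) (ηof∈N y))
                        (·∈ (ηof∈N (to π y)) (ηof∈N p')) ν-πe

  transportsBrace⇒normalizes : ∀ π p' → TransportsBrace π p' → Normalizes π
  transportsBrace⇒normalizes π p' brace η η∈N = resp ηof-c≈conj (ηof∈N c)
    where
    y : G
    y = to η e

    c : G
    c = to π y ⋆ p'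

    ηof-c≈conj : ηof c ≈ π ∙ η ∙ π ⁻¹
    ηof-c≈conj h = begin
      to (ηof c) h                         ≡⟨ sym (⋆-ηof c h) ⟩
      c ⋆ h                                ≡⟨ cong (c ⋆_) (sym (to-from π h)) ⟩
      c ⋆ to π (from π h)                  ≡⟨ sym (brace y (from π h)) ⟩
      to π (y ⋆ from π h)                  ≡⟨ cong (to π) (⋆-ηof y (from π h)) ⟩
      to π (to (ηof y) (from π h))         ≡⟨ cong (to π) (sym (ηof-unique η∈N (from π h))) ⟩
      to π (to η (from π h))               ∎

  gStable⇒leftBrace : GStable 𝔾 N → LeftBrace
  gStable⇒leftBrace λ-normalizes x x' y z (_ , x'⋆x≡e) =
    normalizes⇒transportsBrace (λₚ 𝔾 x) x'⋆xe≡e (λ-normalizes x) y z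
    where
    x'⋆xe≡e : x' ⋆ (x ∘ e) ≡ e
    x'⋆xe≡e = trans (cong (x' ⋆_) (identityʳ x)) x'⋆x≡e

  ρ-normalizes⇒rightBrace : NormalizedBy 𝔾 (ρₚ 𝔾) N → RightBrace
  ρ-normalizes⇒rightBrace ρ-normalizes x x' y z (_ , x'⋆x≡e) =
    subst (λ u → (y ⋆ z) ∘ u ≡ ((y ∘ u) ⋆ x') ⋆ (z ∘ u)) (inv-involutive x)
      (normalizes⇒transportsBrace (ρₚ 𝔾 (inv x)) x'⋆ex̿≡e (ρ-normalizes (inv x)) y z)
    where
    x'⋆ex̿≡e : x' ⋆ (e ∘ inv (inv x)) ≡ e
    x'⋆ex̿≡e = trans (cong (x' ⋆_) (trans (identityˡ _) (inv-involutive x))) x'⋆x≡e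

  rightBrace⇒ρ-normalizes : RightBrace → NormalizedBy 𝔾 (ρₚ 𝔾) N
  rightBrace⇒ρ-normalizes brace g =
    transportsBrace⇒normalizes (ρₚ 𝔾 g) x' (λ y z → brace (inv g) x' y z (⋆-inverse (inv g)))
    where
    x' : G
    x' = from (ηof (inv g)) e

corollary4p4 : (𝔾 : FiniteGroup) (N : Perm 𝔾 → Set)
    → IsSubgroup 𝔾 N → (reg : IsRegular 𝔾 N) → GStable 𝔾 N
    → (NormalizedBy 𝔾 (ρₚ 𝔾) N → SkewBrace.IsTwoSided 𝔾 N reg)
    × (SkewBrace.IsTwoSided 𝔾 N reg → NormalizedBy 𝔾 (ρₚ 𝔾) N)
corollary4p4 𝔾 N sub reg gs =
    (λ ρ-normalizes → gStable⇒leftBrace 𝔾 N sub reg gs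
                    , ρ-normalizes⇒rightBrace 𝔾 N sub reg ρ-normalizes)
  , λ twoSided → rightBrace⇒ρ-normalizes 𝔾 N sub reg (proj₂ twoSided)
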